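{- Let $\lambda$ be a real number and let $n\ge k\ge 0$ be integers. Then $$S_\lambda(n,k)=B_{n,k}\big(0!,\,1!\lambda,\,2!\lambda^2,\,\dots,\,(n-k)!\,\lambda^{n-k}\big),$$ with the convention $\lambda^0=1$.
   Context: For real $\lambda$, $\langle x\rangle_{0,\lambda}=1$ and $\langle x\rangle_{n,\lambda}=x(x+\lambda)\cdots(x+(n-1)\lambda)$ for $n\ge1$; the unsigned degenerate Stirling numbers of the first kind $S_\lambda(n,k)$ are defined by $\langle x\rangle_{n,\lambda}=\sum_{k=0}^n S_\lambda(n,k)x^k$. The exponential partial Bell polynomials $B_{n,k}$ are defined by $\frac{1}{k!}\big(\sum_{m\ge1}x_m\frac{t^m}{m!}\big)^k=\sum_{n\ge k}B_{n,k}(x_1,\dots,x_{n-k+1})\frac{t^n}{n!}$ for $k\ge0$; explicitly $B_{n,k}(x_1,\dots,x_{n-k+1})=\sum \frac{n!}{i_1!\cdots i_{n-k+1}!}\prod_{j}\big(\frac{x_j}{j!}\big)^{i_j}$, the sum over nonnegative integers with $\sum_j i_j=k$ and $\sum_j j\,i_j=n$. -}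

module Defs where

open import Algebra.Bundles using (CommutativeRing)
open import Data.Nat as ℕ using (ℕ; zero; suc)
open import Data.Nat.DivMod using (_/_)
open import Data.Nat.Base using () renaming (_! to fact)
open import Data.Bool using (Bool; true; false; if_then_else_; _∧_)
open import Data.List as List using (List; []; _∷_; concatMap; map; upTo)
open import Data.Vec as Vec using (Vec; []; _∷_)

-- Exact natural-number division (used only with a divisor that divides the
-- dividend); a zero divisor never occurs below but is handled totally.
divℕ : ℕ → ℕ → ℕ
divℕ a zero    = 0
divℕ a (suc b) = a / suc b

vecsUpTo : (m b : ℕ) → List (Vec ℕ m)
vecsUpTo zero    b = [] ∷ []
vecsUpTo (suc m) b = concatMap (λ i → map (i ∷_) (vecsUpTo m b)) (upTo (suc b))

vsum : ∀ {m} → Vec ℕ m → ℕ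
vsum []       = 0
vsum (i ∷ is) = i ℕ.+ vsum is

wsum : ∀ {m} → ℕ → Vec ℕ m → ℕ
wsum j []       = 0
wsum j (i ∷ is) = j ℕ.* i ℕ.+ wsum (suc j) is

denom : ∀ {m} → ℕ → Vec ℕ m → ℕ
denom j []       = 1
denom j (i ∷ is) = fact i ℕ.* (fact j ℕ.^ i) ℕ.* denom (suc j) is

module _ {c ℓ} (R : CommutativeRing c ℓ) where
  open CommutativeRing R

  ι : ℕ → Carrier
  ι zero    = 0#
  ι (suc n) = 1# + ι n

  _^R_ : Carrier → ℕ → Carrier
  a ^R zero  = 1#
  a ^R suc n = a * (a ^R n)

  -- Polynomials in x over R as coefficient lists (constant term first).
  Poly : Set c
  Poly = List Carrier

  scale : Carrier → Poly → Poly
  scale a = map (a *_)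

  addP : Poly → Poly → Poly
  addP []       q        = q
  addP (p ∷ ps) []       = p ∷ ps
  addP (p ∷ ps) (q ∷ qs) = (p + q) ∷ addP ps qs

  -- p ↦ p · (x + a)
  mulLin : Carrier → Poly → Poly
  mulLin a p = addP (0# ∷ p) (scale a p)

  coeff : Poly → ℕ → Carrier
  coeff []       k       = 0#
  coeff (p ∷ ps) zero    = p
  coeff (p ∷ ps) (suc k) = coeff ps k

  -- ⟨x⟩_{n,λ} = x (x+λ) ⋯ (x+(n-1)λ),  ⟨x⟩_{0,λ} = 1
  risingλ : Carrier → ℕ → Poly
  risingλ lam zero    = 1# ∷ []
  risingλ lam (suc n) = mulLin (ι n * lam) (risingλ lam n)

  -- unsigned degenerate Stirling numbers of the first kind:
  -- ⟨x⟩_{n,λ} = Σ_k S_λ(n,k) x^k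
  Sλ : Carrier → ℕ → ℕ → Carrier
  Sλ lam n k = coeff (risingλ lam n) k

  -- Exponential partial Bell polynomial B_{n,k}(x_1,…,x_{n-k+1}),
  -- with x given as a function ℕ → R (x j = x_j; x 0 is unused):
  --   Σ n!/(i_1!⋯ i_{n-k+1}!) ∏_j (x_j/j!)^{i_j}
  -- over i with Σ i_j = k and Σ j i_j = n.  The rational coefficient
  -- n!/(∏ i_j! (j!)^{i_j}) is an integer, computed here by exact division.
  monom : ∀ {m} → ℕ → (ℕ → Carrier) → Vec ℕ m → Carrier
  monom j x []       = 1#
  monom j x (i ∷ is) = (x j ^R i) * monom (suc j) x is

  bellTerm : ∀ {m} → ℕ → ℕ → (ℕ → Carrier) → Vec ℕ m → Carrier
  bellTerm n k x is =
    if (vsum is ℕ.≡ᵇ k) ∧ (wsum 1 is ℕ.≡ᵇ n)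
    then ι (divℕ (fact n) (denom 1 is)) * monom 1 x is
    else 0#

  sumR : List Carrier → Carrier
  sumR = List.foldr _+_ 0#

  Bell : ℕ → ℕ → (ℕ → Carrier) → Carrier
  Bell n k x = sumR (map (bellTerm n k x) (vecsUpTo (suc (n ℕ.∸ k)) k))

module Submission where

-- Write c(n,k) for the unsigned Stirling numbers of the
-- first kind, c(n+1,k+1) = c(n,k) + n·c(n,k+1).
--  (1) Comparing coefficients in ⟨x⟩_{n+1,λ} = ⟨x⟩_{n,λ}·(x + nλ) gives
--      S_λ(n,k) = c(n,k)·λ^{n-k}.
--  (2) For x_j = (j-1)!·λ^{j-1}, the monomial of B_{n,k} with exponent vector
--      i (Σ i_j = k, Σ j·i_j = n) equals T(i)·λ^{n-k}, where
--      T(i) = n! / ∏_j i_j!·j^{i_j} is the number of permutations of n letters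
--      with cycle type i.  Hence B_{n,k} = (Σ_i T(i))·λ^{n-k}.
--  (3) The classical count Σ_i T(i) = c(n,k) (sum over cycle types of
--      permutations of n letters with k cycles).  Both sides satisfy the
--      recurrence obtained by removing the cycle through a fixed letter: if it
--      has length p+1 it can be filled in N·(N-1)⋯(N-p+1) ways, so
--      c(N+1,K+1) = Σ_p N^{(p)}·c(N-p,K), and likewise for the cycle-type sums.

open import Defs
open import Algebra.Bundles using (CommutativeRing)
open import Data.Nat using (ℕ; _≤_; _∸_)
open import Data.Nat.Base using (_!)

module Counting where

  open import Data.Nat
    using (zero; suc; _+_; _*_; _^_; _<_; z≤n; s≤s; s≤s⁻¹; pred; NonZero; _≡ᵇ_; _≤?_)
  open import Data.Nat.Properties
  open import Data.Nat.Divisibility using (_∣_; *-pres-∣; ∣-trans; ∣-refl)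
  open import Data.Nat.DivMod using (m/n*n≡m)
  open import Data.Nat.Combinatorics using (k![n∸k]!∣n!)
  open import Data.Bool using (Bool; true; false; if_then_else_; _∧_; T)
  open import Data.Vec using (Vec; []; _∷_)
  open import Data.Product using (_×_; _,_; proj₂)
  open import Data.Empty using (⊥-elim)
  open import Data.Sum using (inj₁; inj₂)
  open import Relation.Nullary using (yes; no)
  open import Relation.Binary.PropositionalEquality
  open import Data.Nat.Tactic.RingSolver using (solve-∀)

  sumTo : ℕ → (ℕ → ℕ) → ℕ
  sumTo zero    g = 0
  sumTo (suc n) g = g 0 + sumTo n (λ i → g (suc i))

  sumTo-cong : ∀ n {f g : ℕ → ℕ} → (∀ i → i < n → f i ≡ g i) → sumTo n f ≡ sumTo n g
  sumTo-cong zero    h = refl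
  sumTo-cong (suc n) h = cong₂ _+_ (h 0 (s≤s z≤n)) (sumTo-cong n (λ i i<n → h (suc i) (s≤s i<n)))

  sumTo-zero : ∀ n {f : ℕ → ℕ} → (∀ i → f i ≡ 0) → sumTo n f ≡ 0
  sumTo-zero zero    h = refl
  sumTo-zero (suc n) h = cong₂ _+_ (h 0) (sumTo-zero n (λ i → h (suc i)))

  sumTo-+ : ∀ n (f g : ℕ → ℕ) → sumTo n (λ i → f i + g i) ≡ sumTo n f + sumTo n g
  sumTo-+ zero    f g = refl
  sumTo-+ (suc n) f g rewrite sumTo-+ n (λ i → f (suc i)) (λ i → g (suc i)) =
    +-+-interchange (f 0) (g 0) (sumTo n (λ i → f (suc i))) (sumTo n (λ i → g (suc i)))
    where
    +-+-interchange : ∀ a b c d → a + b + (c + d) ≡ a + c + (b + d)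
    +-+-interchange = solve-∀

  sumTo-*ˡ : ∀ n k (f : ℕ → ℕ) → sumTo n (λ i → k * f i) ≡ k * sumTo n f
  sumTo-*ˡ zero    k f = sym (*-zeroʳ k)
  sumTo-*ˡ (suc n) k f rewrite sumTo-*ˡ n k (λ i → f (suc i)) = sym (*-distribˡ-+ k (f 0) _)

  sumTo-*ʳ : ∀ n k (f : ℕ → ℕ) → sumTo n f * k ≡ sumTo n (λ i → f i * k)
  sumTo-*ʳ n k f =
    trans (*-comm (sumTo n f) k) (trans (sym (sumTo-*ˡ n k f)) (sumTo-cong n (λ i _ → *-comm k (f i))))

  sumTo-swap : ∀ n k (f : ℕ → ℕ → ℕ) →
    sumTo n (λ i → sumTo k (λ j → f i j)) ≡ sumTo k (λ j → sumTo n (λ i → f i j))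
  sumTo-swap zero    k f = sym (sumTo-zero k (λ _ → refl))
  sumTo-swap (suc n) k f =
    trans (cong (sumTo k (λ j → f 0 j) +_) (sumTo-swap n k (λ i → f (suc i))))
          (sym (sumTo-+ k (λ j → f 0 j) (λ j → sumTo n (λ i → f (suc i) j))))

  sumTo-snoc : ∀ n (g : ℕ → ℕ) → sumTo (suc n) g ≡ sumTo n g + g n
  sumTo-snoc zero    g = +-comm (g 0) 0
  sumTo-snoc (suc n) g rewrite sumTo-snoc n (λ i → g (suc i)) = sym (+-assoc (g 0) _ _)

  sumTo-extend : ∀ n d (g : ℕ → ℕ) → (∀ p → n ≤ p → g p ≡ 0) → sumTo (n + d) g ≡ sumTo n g
  sumTo-extend zero    d g h = sumTo-zero d (λ i → h i z≤n)
  sumTo-extend (suc n) d g h =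
    cong (g 0 +_) (sumTo-extend n d (λ i → g (suc i)) (λ p n≤p → h (suc p) (s≤s n≤p)))

  sumTo-support : ∀ n n' (g : ℕ → ℕ) → (∀ p → n ≤ p → g p ≡ 0) → (∀ p → n' ≤ p → g p ≡ 0) →
    sumTo n g ≡ sumTo n' g
  sumTo-support n n' g h h' with ≤-total n n'
  ... | inj₁ n≤n' =
    sym (trans (cong (λ z → sumTo z g) (sym (m+[n∸m]≡n n≤n'))) (sumTo-extend n (n' ∸ n) g h))
  ... | inj₂ n'≤n =
    trans (cong (λ z → sumTo z g) (sym (m+[n∸m]≡n n'≤n))) (sumTo-extend n' (n ∸ n') g h')

  sumVec : (m b : ℕ) → (Vec ℕ m → ℕ) → ℕ
  sumVec zero    b f = f []
  sumVec (suc m) b f = sumTo (suc b) (λ a → sumVec m b (λ v → f (a ∷ v)))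

  sumVec-cong : ∀ m b {f g : Vec ℕ m → ℕ} → (∀ v → f v ≡ g v) → sumVec m b f ≡ sumVec m b g
  sumVec-cong zero    b h = h []
  sumVec-cong (suc m) b h = sumTo-cong (suc b) (λ a _ → sumVec-cong m b (λ v → h (a ∷ v)))

  sumVec-zero : ∀ m b {f : Vec ℕ m → ℕ} → (∀ v → f v ≡ 0) → sumVec m b f ≡ 0
  sumVec-zero zero    b h = h []
  sumVec-zero (suc m) b h = sumTo-zero (suc b) (λ a → sumVec-zero m b (λ v → h (a ∷ v)))

  sumVec-*ˡ : ∀ m b k (f : Vec ℕ m → ℕ) → sumVec m b (λ v → k * f v) ≡ k * sumVec m b f
  sumVec-*ˡ zero    b k f = refl
  sumVec-*ˡ (suc m) b k f =
    trans (sumTo-cong (suc b) (λ a _ → sumVec-*ˡ m b k (λ v → f (a ∷ v))))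
          (sumTo-*ˡ (suc b) k (λ a → sumVec m b (λ v → f (a ∷ v))))

  sumVec-swap : ∀ m b n (f : ℕ → Vec ℕ m → ℕ) →
    sumVec m b (λ v → sumTo n (λ p → f p v)) ≡ sumTo n (λ p → sumVec m b (f p))
  sumVec-swap zero    b n f = refl
  sumVec-swap (suc m) b n f =
    trans (sumTo-cong (suc b) (λ a _ → sumVec-swap m b n (λ p v → f p (a ∷ v))))
          (sumTo-swap (suc b) n (λ a p → sumVec m b (λ v → f p (a ∷ v))))

  zeros : ∀ m → Vec ℕ m
  zeros zero    = []
  zeros (suc m) = 0 ∷ zeros m

  sumVec-atZeros : ∀ m b (f : Vec ℕ m → ℕ) → (∀ v → vsum v ≢ 0 → f v ≡ 0) → sumVec m b f ≡ f (zeros m)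
  sumVec-atZeros zero    b f h = refl
  sumVec-atZeros (suc m) b f h =
    trans (cong₂ _+_ (sumVec-atZeros m b (λ v → f (0 ∷ v)) (λ v ne → h (0 ∷ v) ne))
                     (sumTo-zero b (λ a → sumVec-zero m b (λ v → h (suc a ∷ v) (λ ())))))
          (+-identityʳ _)

  entry : ∀ {m} → ℕ → Vec ℕ m → ℕ
  entry p       []      = 0
  entry zero    (a ∷ v) = a
  entry (suc p) (a ∷ v) = entry p v

  decAt : ∀ {m} → ℕ → Vec ℕ m → Vec ℕ m
  decAt p       []      = []
  decAt zero    (a ∷ v) = pred a ∷ v
  decAt (suc p) (a ∷ v) = a ∷ decAt p v

  whenPos : ℕ → ℕ → ℕ
  whenPos zero    y = 0
  whenPos (suc _) y = y

  whenBelow : ℕ → ℕ → ℕ → ℕ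
  whenBelow zero    x       y = 0
  whenBelow (suc b) zero    y = y
  whenBelow (suc b) (suc x) y = whenBelow b x y

  whenBelow-< : ∀ b x y → x < b → whenBelow b x y ≡ y
  whenBelow-< (suc b) zero    y _          = refl
  whenBelow-< (suc b) (suc x) y (s≤s x<b) = whenBelow-< b x y x<b

  whenBelow-≡ : ∀ b y → whenBelow b b y ≡ 0
  whenBelow-≡ zero    y = refl
  whenBelow-≡ (suc b) y = whenBelow-≡ b y

  whenBelow-0 : ∀ b x → whenBelow b x 0 ≡ 0
  whenBelow-0 zero    x       = refl
  whenBelow-0 (suc b) zero    = refl
  whenBelow-0 (suc b) (suc x) = whenBelow-0 b x

  whenPos-0 : ∀ x → whenPos x 0 ≡ 0
  whenPos-0 zero    = refl
  whenPos-0 (suc x) = refl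

  -- Reindexing v = u + e_p: summing H(v - e_p) over the v with v_p > 0 is
  -- summing H(u) over the u with u_p < b.
  sumVec-reindex : ∀ m b p (H : Vec ℕ m → ℕ) → p < m →
    sumVec m b (λ v → whenPos (entry p v) (H (decAt p v))) ≡ sumVec m b (λ u → whenBelow b (entry p u) (H u))
  sumVec-reindex (suc m) b zero H _ = begin
      sumVec m b (λ _ → 0) + sumTo b (λ a → sumVec m b (λ v → H (a ∷ v)))
        ≡⟨ cong (_+ sumTo b (λ a → sumVec m b (λ v → H (a ∷ v)))) (sumVec-zero m b (λ _ → refl)) ⟩
      sumTo b (λ a → sumVec m b (λ v → H (a ∷ v)))
        ≡⟨ sumTo-cong b (λ a a<b → sumVec-cong m b (λ v → sym (whenBelow-< b a _ a<b))) ⟩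
      sumTo b G
        ≡⟨ sym (+-identityʳ _) ⟩
      sumTo b G + 0
        ≡⟨ cong (sumTo b G +_) (sym (sumVec-zero m b (λ v → whenBelow-≡ b (H (b ∷ v))))) ⟩
      sumTo b G + G b
        ≡⟨ sym (sumTo-snoc b G) ⟩
      sumTo (suc b) G ∎
    where
    open ≡-Reasoning
    G : ℕ → ℕ
    G a = sumVec m b (λ v → whenBelow b a (H (a ∷ v)))
  sumVec-reindex (suc m) b (suc p) H (s≤s p<m) =
    sumTo-cong (suc b) (λ a _ → sumVec-reindex m b p (λ u → H (a ∷ u)) p<m)

  -- For an exponent vector v whose entries count cycles of lengths j, j+1, …:
  -- centralizer j v = ∏ v_a!·(j+a)^{v_a}, the order of the centralizer of a
  -- permutation of that cycle type, and cycleWeight j v = ∏ ((j+a-1)!)^{v_a}.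
  centralizer : ∀ {m} → ℕ → Vec ℕ m → ℕ
  centralizer j []      = 1
  centralizer j (a ∷ v) = a ! * j ^ a * centralizer (suc j) v

  cycleWeight : ∀ {m} → ℕ → Vec ℕ m → ℕ
  cycleWeight j []      = 1
  cycleWeight j (a ∷ v) = ((j ∸ 1) !) ^ a * cycleWeight (suc j) v

  ^-distrib-* : ∀ x y a → (x * y) ^ a ≡ x ^ a * y ^ a
  ^-distrib-* x y zero    = refl
  ^-distrib-* x y (suc a) rewrite ^-distrib-* x y a = [m*n]*[o*p]≡[m*o]*[n*p] x y (x ^ a) (y ^ a)

  -- The Bell denominator ∏ v_a!·((j+a)!)^{v_a} splits as centralizer × weight,
  -- since (j+a)! = (j+a)·(j+a-1)!.
  denom≡centralizer*weight : ∀ {m} j (v : Vec ℕ m) →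
    denom (suc j) v ≡ centralizer (suc j) v * cycleWeight (suc j) v
  denom≡centralizer*weight j []      = refl
  denom≡centralizer*weight j (a ∷ v)
    rewrite denom≡centralizer*weight (suc j) v | ^-distrib-* (suc j) (j !) a =
    regroup (a !) (suc j ^ a) ((j !) ^ a) (centralizer (suc (suc j)) v) (cycleWeight (suc (suc j)) v)
    where
    regroup : ∀ A B C D E → A * (B * C) * (D * E) ≡ A * B * D * (C * E)
    regroup = solve-∀

  -- With L = j+1, a!·(L!)^a divides (L·a)!: the number of ways to split L·a
  -- letters into a unordered blocks of size L is an integer.
  blocks∣ : ∀ j a → a ! * ((suc j) !) ^ a ∣ (suc j * a) !
  blocks∣ j zero rewrite *-zeroʳ j = ∣-refl
  blocks∣ j (suc a) = subst₂ _∣_ lhs≡ rhs≡ step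
    where
    L = suc j
    newBlock : j ! * (L * a) ! ∣ (j + L * a) !
    newBlock = subst (λ z → j ! * z ! ∣ (j + L * a) !) (m+n∸m≡n j (L * a)) (k![n∸k]!∣n! (m≤m+n j (L * a)))
    step : suc (j + L * a) * (j ! * (a ! * (L !) ^ a)) ∣ suc (j + L * a) * (j + L * a) !
    step = *-pres-∣ (∣-refl {suc (j + L * a)}) (∣-trans (*-pres-∣ (∣-refl {j !}) (blocks∣ j a)) newBlock)
    lhs≡ : suc (j + L * a) * (j ! * (a ! * (L !) ^ a)) ≡ suc a ! * (L !) ^ suc a
    lhs≡ = trans (cong (λ z → z * (j ! * (a ! * (L !) ^ a))) (trans (sym (*-suc L a)) (*-comm L (suc a))))
                 (regroup (suc a) L (j !) (a !) ((L !) ^ a))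
      where
      regroup : ∀ A B C D E → A * B * (C * (D * E)) ≡ A * D * (B * C * E)
      regroup = solve-∀
    rhs≡ : suc (j + L * a) * (j + L * a) ! ≡ (L * suc a) !
    rhs≡ = cong _! (sym (*-suc L a))

  denom∣ : ∀ {m} j (v : Vec ℕ m) → denom (suc j) v ∣ (wsum (suc j) v) !
  denom∣ j []      = ∣-refl
  denom∣ j (a ∷ v) = ∣-trans (*-pres-∣ (blocks∣ j a) (denom∣ (suc j) v))
    (subst (λ z → (suc j * a) ! * z ! ∣ (suc j * a + W) !) (m+n∸m≡n (suc j * a) W)
       (k![n∸k]!∣n! (m≤m+n (suc j * a) W)))
    where W = wsum (suc (suc j)) v

  denom≢0 : ∀ {m} j (v : Vec ℕ m) → NonZero (denom j v)
  denom≢0 j []      = _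
  denom≢0 j (a ∷ v) = m*n≢0 _ _ {{m*n≢0 _ _ {{a !≢0}} {{m^n≢0 (j !) a {{j !≢0}}}}}} {{denom≢0 (suc j) v}}

  centralizer≢0 : ∀ {m} j (v : Vec ℕ m) → NonZero (centralizer (suc j) v)
  centralizer≢0 j []      = _
  centralizer≢0 j (a ∷ v) =
    m*n≢0 _ _ {{m*n≢0 _ _ {{a !≢0}} {{m^n≢0 (suc j) a}}}} {{centralizer≢0 (suc j) v}}

  -- The integer coefficient of a Bell monomial times its weight:
  -- cycleCount v = n!/∏ v_j!·j^{v_j}, the number of permutations of type v.
  cycleCount : ∀ {m} → Vec ℕ m → ℕ
  cycleCount v = divℕ ((wsum 1 v) !) (denom 1 v) * cycleWeight 1 v

  -- T(v)·z(v) = n!: the defining property of the cycle count (orbit-stabiliser),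
  -- obtained from the exact division n!/denom.
  cycleCount*centralizer : ∀ {m} (v : Vec ℕ m) → cycleCount v * centralizer 1 v ≡ (wsum 1 v) !
  cycleCount*centralizer v = begin
      q * cycleWeight 1 v * centralizer 1 v   ≡⟨ regroup q (cycleWeight 1 v) (centralizer 1 v) ⟩
      q * (centralizer 1 v * cycleWeight 1 v) ≡⟨ cong (q *_) (sym (denom≡centralizer*weight 0 v)) ⟩
      q * denom 1 v                           ≡⟨ exact-division (denom≢0 1 v) (denom∣ 0 v) ⟩
      (wsum 1 v) ! ∎
    where
    open ≡-Reasoning
    q = divℕ ((wsum 1 v) !) (denom 1 v)
    regroup : ∀ A B C → A * B * C ≡ A * (C * B)
    regroup = solve-∀
    exact-division : ∀ {a d} → NonZero d → d ∣ a → divℕ a d * d ≡ a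
    exact-division {d = suc d} _ d∣a = m/n*n≡m d∣a

  -- Removing one cycle of length j+p (the entry at position p) from a cycle type.
  decAt-centralizer : ∀ {m} j p (v : Vec ℕ m) {a} → entry p v ≡ suc a →
    centralizer j v ≡ centralizer j (decAt p v) * (suc a * (j + p))
  decAt-centralizer j p       []      ()
  decAt-centralizer j zero    (x ∷ v) {a} refl rewrite +-identityʳ j =
    regroup (suc a) (a !) j (j ^ a) (centralizer (suc j) v)
    where
    regroup : ∀ A B C D E → A * B * (C * D) * E ≡ B * D * E * (A * C)
    regroup = solve-∀
  decAt-centralizer j (suc p) (x ∷ v) eq rewrite decAt-centralizer (suc j) p v eq | +-suc j p =
    sym (*-assoc (x ! * j ^ x) (centralizer (suc j) (decAt p v)) _)

  decAt-wsum : ∀ {m} j p (v : Vec ℕ m) {a} → entry p v ≡ suc a → wsum j v ≡ wsum j (decAt p v) + (j + p)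
  decAt-wsum j p       []      ()
  decAt-wsum j zero    (x ∷ v) {a} refl rewrite +-identityʳ j | *-suc j a =
    regroup j (j * a) (wsum (suc j) v)
    where
    regroup : ∀ A B C → A + B + C ≡ B + C + A
    regroup = solve-∀
  decAt-wsum j (suc p) (x ∷ v) eq rewrite decAt-wsum (suc j) p v eq | +-suc j p =
    sym (+-assoc (j * x) (wsum (suc j) (decAt p v)) _)

  decAt-vsum : ∀ {m} p (v : Vec ℕ m) {a} → entry p v ≡ suc a → vsum v ≡ suc (vsum (decAt p v))
  decAt-vsum p       []      ()
  decAt-vsum zero    (x ∷ v) refl = refl
  decAt-vsum (suc p) (x ∷ v) eq rewrite decAt-vsum p v eq = +-suc x (vsum (decAt p v))

  sumTo-entry : ∀ {m} j (v : Vec ℕ m) → sumTo m (λ p → (j + p) * entry p v) ≡ wsum j v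
  sumTo-entry j []               = refl
  sumTo-entry {suc m} j (a ∷ v) = cong₂ _+_ (cong (_* a) (+-identityʳ j))
    (trans (sumTo-cong m (λ p _ → cong (_* entry p v) (+-suc j p))) (sumTo-entry (suc j) v))

  falling : ℕ → ℕ → ℕ
  falling n       zero    = 1
  falling zero    (suc p) = 0
  falling (suc n) (suc p) = suc n * falling n p

  falling*! : ∀ N p → p ≤ N → falling N p * (N ∸ p) ! ≡ N !
  falling*! N       zero    _         = *-identityˡ (N !)
  falling*! (suc N) (suc p) (s≤s p≤N) =
    trans (*-assoc (suc N) (falling N p) _) (cong (suc N *_) (falling*! N p p≤N))

  falling-vanishes : ∀ N p → N < p → falling N p ≡ 0
  falling-vanishes zero    (suc p) _         = refl
  falling-vanishes (suc N) (suc p) (s≤s N<p) rewrite falling-vanishes N p N<p = *-zeroʳ (suc N)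

  removeCycle*centralizer : ∀ {m} (v : Vec ℕ m) N p → wsum 1 v ≡ suc N →
    whenPos (entry p v) (falling N p * cycleCount (decAt p v)) * centralizer 1 v ≡ N ! * ((1 + p) * entry p v)
  removeCycle*centralizer v N p wv with entry p v in eq
  ... | zero rewrite *-zeroʳ (suc p) | *-zeroʳ (N !) = refl
  ... | suc a = begin
      falling N p * cycleCount d * centralizer 1 v
        ≡⟨ cong (falling N p * cycleCount d *_) (decAt-centralizer 1 p v eq) ⟩
      falling N p * cycleCount d * (centralizer 1 d * (suc a * suc p))
        ≡⟨ regroup (falling N p) (cycleCount d) (centralizer 1 d) (suc a * suc p) ⟩
      falling N p * (cycleCount d * centralizer 1 d) * (suc a * suc p)
        ≡⟨ cong (λ z → falling N p * z * (suc a * suc p)) (cycleCount*centralizer d) ⟩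
      falling N p * (wsum 1 d) ! * (suc a * suc p)
        ≡⟨ cong (λ z → falling N p * z ! * (suc a * suc p)) wd≡N∸p ⟩
      falling N p * (N ∸ p) ! * (suc a * suc p)
        ≡⟨ cong (_* (suc a * suc p)) (falling*! N p p≤N) ⟩
      N ! * (suc a * suc p)
        ≡⟨ cong (N ! *_) (*-comm (suc a) (suc p)) ⟩
      N ! * (suc p * suc a) ∎
    where
    open ≡-Reasoning
    d = decAt p v
    regroup : ∀ A B C D → A * B * (C * D) ≡ A * (B * C) * D
    regroup = solve-∀
    wd+p≡N : wsum 1 d + p ≡ N
    wd+p≡N = suc-injective (trans (sym (+-suc (wsum 1 d) p)) (trans (sym (decAt-wsum 1 p v eq)) wv))
    wd≡N∸p : wsum 1 d ≡ N ∸ p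
    wd≡N∸p = trans (sym (m+n∸n≡m (wsum 1 d) p)) (cong (_∸ p) wd+p≡N)
    p≤N : p ≤ N
    p≤N = subst (p ≤_) wd+p≡N (m≤n+m p (wsum 1 d))

  -- The cycle-count recurrence: for a type v of N+1 letters,
  -- T(v) = Σ_p N^{(p)}·T(v - e_p), summing over the lengths p+1 of the cycle
  -- through a fixed letter (it follows from (N+1)! = N!·Σ_p (p+1)·v_p).
  cycleCount-rec : ∀ {m} (v : Vec ℕ m) N → wsum 1 v ≡ suc N →
    cycleCount v ≡ sumTo m (λ p → whenPos (entry p v) (falling N p * cycleCount (decAt p v)))
  cycleCount-rec {m} v N wv = *-cancelʳ-≡ _ _ (centralizer 1 v) {{centralizer≢0 0 v}} (begin
      cycleCount v * centralizer 1 v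
        ≡⟨ cycleCount*centralizer v ⟩
      (wsum 1 v) !
        ≡⟨ cong _! wv ⟩
      suc N * N !
        ≡⟨ *-comm (suc N) (N !) ⟩
      N ! * suc N
        ≡⟨ cong (N ! *_) (sym (trans (sumTo-entry 1 v) wv)) ⟩
      N ! * sumTo m (λ p → (1 + p) * entry p v)
        ≡⟨ sym (sumTo-*ˡ m (N !) _) ⟩
      sumTo m (λ p → N ! * ((1 + p) * entry p v))
        ≡⟨ sumTo-cong m (λ p _ → sym (removeCycle*centralizer v N p wv)) ⟩
      sumTo m (λ p → whenPos (entry p v) (falling N p * cycleCount (decAt p v)) * centralizer 1 v)
        ≡⟨ sym (sumTo-*ʳ m (centralizer 1 v) _) ⟩
      sumTo m (λ p → whenPos (entry p v) (falling N p * cycleCount (decAt p v))) * centralizer 1 v ∎)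
    where open ≡-Reasoning

  entry≤vsum : ∀ {m} p (v : Vec ℕ m) → entry p v ≤ vsum v
  entry≤vsum p       []      = z≤n
  entry≤vsum zero    (a ∷ v) = m≤m+n a (vsum v)
  entry≤vsum (suc p) (a ∷ v) = ≤-trans (entry≤vsum p v) (m≤n+m (vsum v) a)

  stirling : ℕ → ℕ → ℕ
  stirling zero    zero    = 1
  stirling zero    (suc k) = 0
  stirling (suc n) zero    = n * stirling n zero
  stirling (suc n) (suc k) = stirling n k + n * stirling n (suc k)

  stirling-vanishes : ∀ n k → n < k → stirling n k ≡ 0
  stirling-vanishes zero    (suc k) _ = refl
  stirling-vanishes (suc n) (suc k) (s≤s n<k)
    rewrite stirling-vanishes n k n<k | stirling-vanishes n (suc k) (m<n⇒m<1+n n<k) = *-zeroʳ n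

  stirling-suc-zero : ∀ N → stirling (suc N) zero ≡ 0
  stirling-suc-zero zero    = refl
  stirling-suc-zero (suc N) rewrite stirling-suc-zero N = *-zeroʳ (suc N)

  -- c(N+1,K+1) = Σ_{p≤N} N^{(p)}·c(N-p,K): classify by the length p+1 of the
  -- cycle through the last letter.
  stirling-rec : ∀ N K → stirling (suc N) (suc K) ≡ sumTo (suc N) (λ p → falling N p * stirling (N ∸ p) K)
  stirling-rec zero    K = sym (+-identityʳ (stirling 0 K + 0))
  stirling-rec (suc N) K = cong₂ _+_ (sym (+-identityʳ (stirling (suc N) K)))
    (trans (cong (suc N *_) (stirling-rec N K))
     (trans (sym (sumTo-*ˡ (suc N) (suc N) (λ p → falling N p * stirling (N ∸ p) K)))
       (sumTo-cong (suc N) (λ p _ → sym (*-assoc (suc N) (falling N p) (stirling (N ∸ p) K))))))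

  -- v is the cycle type of a permutation of N letters with K cycles.  The
  -- condition is literally the one in bellTerm.
  admissible : ∀ {m} → ℕ → ℕ → Vec ℕ m → Bool
  admissible N K v = (vsum v ≡ᵇ K) ∧ (wsum 1 v ≡ᵇ N)

  countIf : ∀ {m} → ℕ → ℕ → Vec ℕ m → ℕ
  countIf N K v = if admissible N K v then cycleCount v else 0

  cycleTypeSum : ℕ → ℕ → ℕ → ℕ → ℕ
  cycleTypeSum m b N K = sumVec m b (countIf N K)

  ≡ᵇ-true : ∀ {m n} → (m ≡ᵇ n) ≡ true → m ≡ n
  ≡ᵇ-true {m} {n} e = ≡ᵇ⇒≡ m n (subst T (sym e) _)

  ∧-true : ∀ {b₁ b₂} → b₁ ∧ b₂ ≡ true → (b₁ ≡ true) × (b₂ ≡ true)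
  ∧-true {true} {true} _ = refl , refl

  ≡ᵇ-cancelʳ-+ : ∀ x y p → (x + p ≡ᵇ y + p) ≡ (x ≡ᵇ y)
  ≡ᵇ-cancelʳ-+ x y zero    rewrite +-identityʳ x | +-identityʳ y = refl
  ≡ᵇ-cancelʳ-+ x y (suc p) rewrite +-suc x p | +-suc y p = ≡ᵇ-cancelʳ-+ x y p

  ≡ᵇ-+suc : ∀ x {p N} → p ≤ N → (x + suc p ≡ᵇ suc N) ≡ (x ≡ᵇ N ∸ p)
  ≡ᵇ-+suc x {p} {N} p≤N rewrite +-suc x p =
    trans (cong (x + p ≡ᵇ_) (sym (m∸n+n≡m p≤N))) (≡ᵇ-cancelʳ-+ x (N ∸ p) p)

  if-same : ∀ c (x : ℕ) → (if c then x else x) ≡ x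
  if-same true  x = refl
  if-same false x = refl

  if-*ˡ : ∀ c k x → (if c then k * x else 0) ≡ k * (if c then x else 0)
  if-*ˡ true  k x = refl
  if-*ˡ false k x = sym (*-zeroʳ k)

  -- A type of N+1 letters with K+1 cycles, with one cycle of length p+1
  -- removed, is a type of N-p letters with K cycles; summing over all types
  -- turns the cycle-count recurrence into the Stirling recurrence.
  cycleTypeSum-rec : ∀ m b N K → K < b →
    cycleTypeSum m b (suc N) (suc K) ≡ sumTo m (λ p → falling N p * cycleTypeSum m b (N ∸ p) K)
  cycleTypeSum-rec m b N K K<b = begin
      sumVec m b (countIf (suc N) (suc K))
        ≡⟨ sumVec-cong m b expand ⟩
      sumVec m b (λ v → sumTo m (λ p → whenPos (entry p v) (removed p v)))
        ≡⟨ sumVec-swap m b m _ ⟩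
      sumTo m (λ p → sumVec m b (λ v → whenPos (entry p v) (removed p v)))
        ≡⟨ sumTo-cong m perLength ⟩
      sumTo m (λ p → falling N p * cycleTypeSum m b (N ∸ p) K) ∎
    where
    open ≡-Reasoning
    removed : ℕ → Vec ℕ m → ℕ
    removed p v = if admissible (suc N) (suc K) v then falling N p * cycleCount (decAt p v) else 0

    expand : ∀ v → countIf (suc N) (suc K) v ≡ sumTo m (λ p → whenPos (entry p v) (removed p v))
    expand v with admissible (suc N) (suc K) v in e
    ... | true  = cycleCount-rec v N (≡ᵇ-true (proj₂ (∧-true e)))
    ... | false = sym (sumTo-zero m (λ p → whenPos-0 (entry p v)))

    -- the admissibility of v expressed on u = v - e_p
    shifted : ℕ → Vec ℕ m → ℕ
    shifted p u = if (vsum u ≡ᵇ K) ∧ (wsum 1 u + suc p ≡ᵇ suc N) then falling N p * cycleCount u else 0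

    removed≡shifted : ∀ p v → whenPos (entry p v) (removed p v) ≡ whenPos (entry p v) (shifted p (decAt p v))
    removed≡shifted p v with entry p v in eq
    ... | zero  = refl
    ... | suc a rewrite decAt-vsum p v eq | decAt-wsum 1 p v eq = refl

    -- an admissible u has all entries ≤ K < b
    shifted-bounded : ∀ p u → whenBelow b (entry p u) (shifted p u) ≡ shifted p u
    shifted-bounded p u with vsum u ≡ᵇ K in e
    ... | true  = whenBelow-< b (entry p u) _ (≤-<-trans (subst (entry p u ≤_) (≡ᵇ-true e) (entry≤vsum p u)) K<b)
    ... | false = whenBelow-0 b (entry p u)

    -- for p > N the factor N^{(p)} vanishes on both sides
    shifted≡ : ∀ p u → shifted p u ≡ falling N p * countIf (N ∸ p) K u
    shifted≡ p u with p ≤? N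
    ... | yes p≤N rewrite ≡ᵇ-+suc (wsum 1 u) p≤N = if-*ˡ _ (falling N p) (cycleCount u)
    ... | no  p≰N rewrite falling-vanishes N p (≰⇒> p≰N) = if-same _ 0

    perLength : ∀ p → p < m →
      sumVec m b (λ v → whenPos (entry p v) (removed p v)) ≡ falling N p * cycleTypeSum m b (N ∸ p) K
    perLength p p<m = begin
      sumVec m b (λ v → whenPos (entry p v) (removed p v))
        ≡⟨ sumVec-cong m b (removed≡shifted p) ⟩
      sumVec m b (λ v → whenPos (entry p v) (shifted p (decAt p v)))
        ≡⟨ sumVec-reindex m b p (shifted p) p<m ⟩
      sumVec m b (λ u → whenBelow b (entry p u) (shifted p u))
        ≡⟨ sumVec-cong m b (shifted-bounded p) ⟩
      sumVec m b (shifted p)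
        ≡⟨ sumVec-cong m b (shifted≡ p) ⟩
      sumVec m b (λ u → falling N p * countIf (N ∸ p) K u)
        ≡⟨ sumVec-*ˡ m b (falling N p) _ ⟩
      falling N p * cycleTypeSum m b (N ∸ p) K ∎

  vsum-zeros : ∀ m → vsum (zeros m) ≡ 0
  vsum-zeros zero    = refl
  vsum-zeros (suc m) = vsum-zeros m

  wsum-zeros : ∀ m j → wsum j (zeros m) ≡ 0
  wsum-zeros zero    j = refl
  wsum-zeros (suc m) j rewrite *-zeroʳ j = wsum-zeros m (suc j)

  denom-zeros : ∀ m j → denom j (zeros m) ≡ 1
  denom-zeros zero    j = refl
  denom-zeros (suc m) j rewrite denom-zeros m (suc j) = refl

  cycleWeight-zeros : ∀ m j → cycleWeight j (zeros m) ≡ 1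
  cycleWeight-zeros zero    j = refl
  cycleWeight-zeros (suc m) j rewrite cycleWeight-zeros m (suc j) = refl

  countIf-zeros : ∀ m → countIf 0 0 (zeros m) ≡ 1
  countIf-zeros m rewrite vsum-zeros m | wsum-zeros m 1 | denom-zeros m 1 | cycleWeight-zeros m 1 = refl

  wsum-suc : ∀ {m} j (v : Vec ℕ m) → wsum (suc j) v ≡ wsum j v + vsum v
  wsum-suc j []      = refl
  wsum-suc j (a ∷ v) rewrite wsum-suc (suc j) v = regroup (j * a) a (wsum (suc j) v) (vsum v)
    where
    regroup : ∀ A B C D → B + A + (C + D) ≡ A + C + (B + D)
    regroup = solve-∀

  vsum≤wsum : ∀ {m} j (v : Vec ℕ m) → vsum v ≤ wsum (suc j) v
  vsum≤wsum j []      = z≤n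
  vsum≤wsum j (a ∷ v) = +-mono-≤ (subst (a ≤_) (*-comm a (suc j)) (m≤m*n a (suc j))) (vsum≤wsum (suc j) v)

  vsum≡0⇒wsum≡0 : ∀ {m} j (v : Vec ℕ m) → vsum v ≡ 0 → wsum j v ≡ 0
  vsum≡0⇒wsum≡0 j []         _ = refl
  vsum≡0⇒wsum≡0 j (zero ∷ v) e rewrite *-zeroʳ j = vsum≡0⇒wsum≡0 (suc j) v e

  -- With N < m + K, the terms p ≥ m of the Stirling recurrence vanish: a
  -- remaining N-p letters cannot form K cycles.
  stirlingTerm-vanishes : ∀ m N K p → N < m + K → m ≤ p → falling N p * stirling (N ∸ p) K ≡ 0
  stirlingTerm-vanishes m N K p N<m+K m≤p with p ≤? N
  ... | no  p≰N rewrite falling-vanishes N p (≰⇒> p≰N) = refl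
  ... | yes p≤N with K
  ...   | zero   = ⊥-elim (<⇒≱ N<m+K (subst (_≤ N) (sym (+-identityʳ m)) (≤-trans m≤p p≤N)))
  ...   | suc K' rewrite stirling-vanishes (N ∸ p) (suc K')
            (m<n+o⇒m∸n<o N p (<-≤-trans N<m+K (+-monoˡ-≤ (suc K') m≤p))) = *-zeroʳ (falling N p)

  cycleTypeSum≡stirling : ∀ m b K N → K ≤ b → N < m + K → cycleTypeSum m b N K ≡ stirling N K
  cycleTypeSum≡stirling m b zero zero _ _ =
    trans (sumVec-atZeros m b (countIf 0 0) onlyZeros) (countIf-zeros m)
    where
    onlyZeros : ∀ v → vsum v ≢ 0 → countIf 0 0 v ≡ 0
    onlyZeros v ne with vsum v ≡ᵇ 0 in e
    ... | true  = ⊥-elim (ne (≡ᵇ-true e))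
    ... | false = refl
  cycleTypeSum≡stirling m b zero (suc N) _ _ = trans (sumVec-zero m b none) (sym (stirling-suc-zero N))
    where
    none : ∀ v → countIf (suc N) 0 v ≡ 0
    none v with vsum v ≡ᵇ 0 in e
    ... | false = refl
    ... | true rewrite vsum≡0⇒wsum≡0 1 v (≡ᵇ-true e) = refl
  cycleTypeSum≡stirling m b (suc K) zero _ _ = sumVec-zero m b none
    where
    none : ∀ v → countIf 0 (suc K) v ≡ 0
    none v with vsum v ≡ᵇ suc K in e | wsum 1 v ≡ᵇ 0 in e′
    ... | false | _     = refl
    ... | true  | false = refl
    ... | true  | true  with subst₂ _≤_ (≡ᵇ-true e) (≡ᵇ-true e′) (vsum≤wsum 0 v)
    ...   | ()
  cycleTypeSum≡stirling m b (suc K) (suc N) K<b N+1<m+K+1 = begin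
      cycleTypeSum m b (suc N) (suc K)  ≡⟨ cycleTypeSum-rec m b N K K<b ⟩
      sumTo m (λ p → falling N p * cycleTypeSum m b (N ∸ p) K)
        ≡⟨ sumTo-cong m (λ p _ → cong (falling N p *_) (cycleTypeSum≡stirling m b K (N ∸ p) (<⇒≤ K<b)
                                                         (≤-<-trans (m∸n≤m N p) N<m+K))) ⟩
      sumTo m term
        ≡⟨ sumTo-support m (suc N) term (λ p m≤p → stirlingTerm-vanishes m N K p N<m+K m≤p)
             (λ p N<p → cong (_* stirling (N ∸ p) K) (falling-vanishes N p N<p)) ⟩
      sumTo (suc N) term                ≡⟨ sym (stirling-rec N K) ⟩
      stirling (suc N) (suc K) ∎
    where
    open ≡-Reasoning
    term : ℕ → ℕ
    term p = falling N p * stirling (N ∸ p) K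
    N<m+K : N < m + K
    N<m+K = s≤s⁻¹ (subst (suc N <_) (+-suc m K) N+1<m+K+1)

open Counting
  using (sumTo; sumVec; stirling; stirling-vanishes; cycleWeight; cycleCount; countIf;
         cycleTypeSum; cycleTypeSum≡stirling; wsum-suc; ≡ᵇ-true; ∧-true)

module RingPart {c ℓ} (R : CommutativeRing c ℓ) where

  open CommutativeRing R
  open import Data.Nat as ℕ using (zero; suc; _≡ᵇ_)
  import Data.Nat.Properties as ℕₚ
  open import Data.Vec using (Vec; []; _∷_)
  open import Data.List using (List; []; _∷_; _++_; map; concatMap; applyUpTo)
  open import Data.List.Properties using (map-++; map-∘)
  open import Data.Bool using (true; false; _∧_)
  open import Data.Product using (proj₁; proj₂)
  open import Relation.Nullary using (yes; no)
  open import Relation.Binary.PropositionalEquality as ≡ using (_≡_)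
  open import Relation.Binary.Reasoning.Setoid setoid
  open import Algebra.Properties.CommutativeSemigroup *-commutativeSemigroup using (interchange; x∙yz≈y∙xz)
  open import Algebra.Properties.Semiring.Mult semiring using (_×_; ×-homo-+; ×1-homo-*)
  open import Algebra.Properties.CommutativeSemiring.Exp commutativeSemiring
    using (_^_; ^-congˡ; ^-homo-*; ^-assocʳ; ^-distrib-*)

  ιR : ℕ → Carrier
  ιR = ι R

  infixr 8 _^ᴿ_
  _^ᴿ_ : Carrier → ℕ → Carrier
  _^ᴿ_ = _^R_ R

  -- ι and _^R_ of Defs agree with the library's n × 1# and x ^ n, so their
  -- homomorphism laws are transported from the library.
  ι≈×1 : ∀ n → ιR n ≈ n × 1#
  ι≈×1 zero    = refl
  ι≈×1 (suc n) = +-congˡ (ι≈×1 n)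

  ^ᴿ≈^ : ∀ x n → x ^ᴿ n ≈ x ^ n
  ^ᴿ≈^ x zero    = refl
  ^ᴿ≈^ x (suc n) = *-congˡ (^ᴿ≈^ x n)

  ι-+ : ∀ a b → ιR (a ℕ.+ b) ≈ ιR a + ιR b
  ι-+ a b = trans (ι≈×1 (a ℕ.+ b)) (trans (×-homo-+ 1# a b) (sym (+-cong (ι≈×1 a) (ι≈×1 b))))

  ι-* : ∀ a b → ιR (a ℕ.* b) ≈ ιR a * ιR b
  ι-* a b = trans (ι≈×1 (a ℕ.* b)) (trans (×1-homo-* a b) (sym (*-cong (ι≈×1 a) (ι≈×1 b))))

  ι-^ : ∀ m a → ιR (m ℕ.^ a) ≈ ιR m ^ᴿ a
  ι-^ m zero    = +-identityʳ 1#
  ι-^ m (suc a) = trans (ι-* m (m ℕ.^ a)) (*-congˡ (ι-^ m a))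

  ^ᴿ-+ : ∀ x m n → x ^ᴿ (m ℕ.+ n) ≈ x ^ᴿ m * x ^ᴿ n
  ^ᴿ-+ x m n = trans (^ᴿ≈^ x (m ℕ.+ n)) (trans (^-homo-* x m n) (sym (*-cong (^ᴿ≈^ x m) (^ᴿ≈^ x n))))

  ^ᴿ-distrib-* : ∀ x y a → (x * y) ^ᴿ a ≈ x ^ᴿ a * y ^ᴿ a
  ^ᴿ-distrib-* x y a = trans (^ᴿ≈^ _ a) (trans (^-distrib-* x y a) (sym (*-cong (^ᴿ≈^ x a) (^ᴿ≈^ y a))))

  ^ᴿ-assoc : ∀ x j a → (x ^ᴿ j) ^ᴿ a ≈ x ^ᴿ (j ℕ.* a)
  ^ᴿ-assoc x j a =
    trans (^ᴿ≈^ _ a) (trans (^-congˡ a (^ᴿ≈^ x j)) (trans (^-assocʳ x j a) (sym (^ᴿ≈^ x (j ℕ.* a)))))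

  coeff-mulLin : ∀ a p k → coeff R (mulLin R a p) k ≈ coeff R (0# ∷ p) k + a * coeff R p k
  coeff-mulLin a p k = trans (coeff-addP (0# ∷ p) (scale R a p) k) (+-congˡ (coeff-scale p k))
    where
    coeff-addP : ∀ p q k → coeff R (addP R p q) k ≈ coeff R p k + coeff R q k
    coeff-addP []      q       k       = sym (+-identityˡ _)
    coeff-addP (x ∷ p) []      zero    = sym (+-identityʳ _)
    coeff-addP (x ∷ p) []      (suc k) = sym (+-identityʳ _)
    coeff-addP (x ∷ p) (y ∷ q) zero    = refl
    coeff-addP (x ∷ p) (y ∷ q) (suc k) = coeff-addP p q k
    coeff-scale : ∀ p k → coeff R (scale R a p) k ≈ a * coeff R p k
    coeff-scale []      k       = sym (zeroʳ a)
    coeff-scale (x ∷ p) zero    = refl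
    coeff-scale (x ∷ p) (suc k) = coeff-scale p k

  -- λ·c(n,k+1)·λ^{n-k-1} = c(n,k+1)·λ^{n-k}; when k ≥ n both sides vanish.
  absorb-λ : ∀ lam n k →
    lam * (ιR (stirling n (suc k)) * lam ^ᴿ (n ∸ suc k)) ≈ ιR (stirling n (suc k)) * lam ^ᴿ (n ∸ k)
  absorb-λ lam n k with k ℕ.<? n
  ... | yes k<n =
    trans (x∙yz≈y∙xz lam _ _) (*-congˡ (reflexive (≡.cong (lam ^ᴿ_) (≡.sym (ℕₚ.+-∸-assoc 1 k<n)))))
  ... | no  k≮n rewrite stirling-vanishes n (suc k) (ℕ.s≤s (ℕₚ.≮⇒≥ k≮n)) =
    trans (*-congˡ (zeroˡ _)) (trans (zeroʳ lam) (sym (zeroˡ _)))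

  Sλ≈stirling : ∀ lam n k → Sλ R lam n k ≈ ιR (stirling n k) * lam ^ᴿ (n ∸ k)
  Sλ≈stirling lam zero    zero    = sym (trans (*-identityʳ _) (+-identityʳ 1#))
  Sλ≈stirling lam zero    (suc k) = sym (zeroˡ _)
  Sλ≈stirling lam (suc n) zero    = begin
    Sλ R lam (suc n) 0                                 ≈⟨ coeff-mulLin a p 0 ⟩
    0# + a * Sλ R lam n 0                              ≈⟨ +-identityˡ _ ⟩
    a * Sλ R lam n 0                                   ≈⟨ *-congˡ (Sλ≈stirling lam n 0) ⟩
    (ιR n * lam) * (ιR (stirling n 0) * lam ^ᴿ n)      ≈⟨ interchange _ _ _ _ ⟩
    (ιR n * ιR (stirling n 0)) * (lam * lam ^ᴿ n)      ≈⟨ *-congʳ (sym (ι-* n (stirling n 0))) ⟩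
    ιR (stirling (suc n) 0) * lam ^ᴿ suc n             ∎
    where
    p = risingλ R lam n
    a = ιR n * lam
  Sλ≈stirling lam (suc n) (suc k) = begin
    Sλ R lam (suc n) (suc k)                           ≈⟨ coeff-mulLin a p (suc k) ⟩
    Sλ R lam n k + a * Sλ R lam n (suc k)
      ≈⟨ +-cong (Sλ≈stirling lam n k) (*-congˡ (Sλ≈stirling lam n (suc k))) ⟩
    ιR (stirling n k) * lam ^ᴿ (n ∸ k) + (ιR n * lam) * (ιR (stirling n (suc k)) * lam ^ᴿ (n ∸ suc k))
      ≈⟨ +-congˡ (trans (*-assoc _ _ _) (*-congˡ (absorb-λ lam n k))) ⟩
    ιR (stirling n k) * lam ^ᴿ (n ∸ k) + ιR n * (ιR (stirling n (suc k)) * lam ^ᴿ (n ∸ k))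
      ≈⟨ +-congˡ (sym (*-assoc _ _ _)) ⟩
    ιR (stirling n k) * lam ^ᴿ (n ∸ k) + (ιR n * ιR (stirling n (suc k))) * lam ^ᴿ (n ∸ k)
      ≈⟨ sym (distribʳ _ _ _) ⟩
    (ιR (stirling n k) + ιR n * ιR (stirling n (suc k))) * lam ^ᴿ (n ∸ k)
      ≈⟨ *-congʳ (sym (trans (ι-+ (stirling n k) _) (+-congˡ (ι-* n (stirling n (suc k)))))) ⟩
    ιR (stirling (suc n) (suc k)) * lam ^ᴿ (suc n ∸ suc k) ∎
    where
    p = risingλ R lam n
    a = ιR n * lam

  xfun : Carrier → ℕ → Carrier
  xfun lam j = ιR ((j ∸ 1) !) * lam ^ᴿ (j ∸ 1)

  monom≈ : ∀ lam {m} j (v : Vec ℕ m) →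
    monom R (suc j) (xfun lam) v ≈ ιR (cycleWeight (suc j) v) * lam ^ᴿ wsum j v
  monom≈ lam j []      = sym (trans (*-identityʳ _) (+-identityʳ 1#))
  monom≈ lam j (a ∷ v) = begin
    xfun lam (suc j) ^ᴿ a * monom R (suc (suc j)) (xfun lam) v
      ≈⟨ *-cong (^ᴿ-distrib-* _ _ a) (monom≈ lam (suc j) v) ⟩
    (ιR (j !) ^ᴿ a * (lam ^ᴿ j) ^ᴿ a) * (ιR (cycleWeight (suc (suc j)) v) * lam ^ᴿ wsum (suc j) v)
      ≈⟨ *-congʳ (*-cong (sym (ι-^ (j !) a)) (^ᴿ-assoc lam j a)) ⟩
    (ιR ((j !) ℕ.^ a) * lam ^ᴿ (j ℕ.* a)) * (ιR (cycleWeight (suc (suc j)) v) * lam ^ᴿ wsum (suc j) v)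
      ≈⟨ interchange _ _ _ _ ⟩
    (ιR ((j !) ℕ.^ a) * ιR (cycleWeight (suc (suc j)) v)) * (lam ^ᴿ (j ℕ.* a) * lam ^ᴿ wsum (suc j) v)
      ≈⟨ *-cong (sym (ι-* ((j !) ℕ.^ a) _)) (sym (^ᴿ-+ lam (j ℕ.* a) (wsum (suc j) v))) ⟩
    ιR (cycleWeight (suc j) (a ∷ v)) * lam ^ᴿ wsum j (a ∷ v) ∎

  bellTerm≈ : ∀ lam n k {m} (v : Vec ℕ m) → bellTerm R n k (xfun lam) v ≈ ιR (countIf n k v) * lam ^ᴿ (n ∸ k)
  bellTerm≈ lam n k v with (vsum v ≡ᵇ k) ∧ (wsum 1 v ≡ᵇ n) in e
  ... | false = sym (zeroˡ _)
  ... | true  = begin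
      ιR q * monom R 1 (xfun lam) v                   ≈⟨ *-congˡ (monom≈ lam 0 v) ⟩
      ιR q * (ιR (cycleWeight 1 v) * lam ^ᴿ wsum 0 v) ≈⟨ sym (*-assoc _ _ _) ⟩
      (ιR q * ιR (cycleWeight 1 v)) * lam ^ᴿ wsum 0 v
        ≈⟨ *-cong (sym (ι-* q (cycleWeight 1 v))) (reflexive (≡.cong (lam ^ᴿ_) exponent)) ⟩
      ιR (q ℕ.* cycleWeight 1 v) * lam ^ᴿ (n ∸ k)
        ≈⟨ *-congʳ (reflexive (≡.cong (λ z → ιR (divℕ (z !) (denom 1 v) ℕ.* cycleWeight 1 v))
                                      (≡.sym letters))) ⟩
      ιR (cycleCount v) * lam ^ᴿ (n ∸ k) ∎
    where
    q = divℕ (n !) (denom 1 v)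
    letters : wsum 1 v ≡ n
    letters = ≡ᵇ-true (proj₂ (∧-true e))
    cycles : vsum v ≡ k
    cycles = ≡ᵇ-true (proj₁ (∧-true e))
    -- Σ (j-1)·v_j = Σ j·v_j − Σ v_j = n − k
    exponent : wsum 0 v ≡ n ∸ k
    exponent = ≡.trans (≡.sym (ℕₚ.m+n∸n≡m (wsum 0 v) (vsum v)))
                       (≡.cong₂ _∸_ (≡.trans (≡.sym (wsum-suc 0 v)) letters) cycles)

  sumR-++ : ∀ xs ys → sumR R (xs ++ ys) ≈ sumR R xs + sumR R ys
  sumR-++ []       ys = sym (+-identityˡ _)
  sumR-++ (x ∷ xs) ys = trans (+-congˡ (sumR-++ xs ys)) (sym (+-assoc _ _ _))

  sumR-vecsUpTo : ∀ m b (F : Vec ℕ m → Carrier) (G : Vec ℕ m → ℕ) z →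
    (∀ v → F v ≈ ιR (G v) * z) → sumR R (map F (vecsUpTo m b)) ≈ ιR (sumVec m b G) * z
  sumR-vecsUpTo zero    b F G z h = trans (+-identityʳ _) (h [])
  sumR-vecsUpTo (suc m) b F G z h = blocks (suc b) (λ i → i)
    where
    block : ℕ → List (Vec ℕ (suc m))
    block i = map (i ∷_) (vecsUpTo m b)
    blocks : ∀ n (f : ℕ → ℕ) → sumR R (map F (concatMap block (applyUpTo f n)))
             ≈ ιR (sumTo n (λ a → sumVec m b (λ v → G (f a ∷ v)))) * z
    blocks zero    f = sym (zeroˡ z)
    blocks (suc n) f = begin
      sumR R (map F (block (f 0) ++ rest))
        ≈⟨ reflexive (≡.cong (sumR R) (map-++ F (block (f 0)) rest)) ⟩
      sumR R (map F (block (f 0)) ++ map F rest)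
        ≈⟨ sumR-++ (map F (block (f 0))) (map F rest) ⟩
      sumR R (map F (block (f 0))) + sumR R (map F rest)
        ≈⟨ +-cong (trans (reflexive (≡.cong (sumR R) (≡.sym (map-∘ (vecsUpTo m b)))))
                         (sumR-vecsUpTo m b (λ v → F (f 0 ∷ v)) (λ v → G (f 0 ∷ v)) z (λ v → h (f 0 ∷ v))))
                  (blocks n (λ i → f (suc i))) ⟩
      ιR first * z + ιR others * z      ≈⟨ sym (distribʳ _ _ _) ⟩
      (ιR first + ιR others) * z        ≈⟨ *-congʳ (sym (ι-+ first others)) ⟩
      ιR (first ℕ.+ others) * z ∎
      where
      rest = concatMap block (applyUpTo (λ i → f (suc i)) n)
      first = sumVec m b (λ v → G (f 0 ∷ v))
      others = sumTo n (λ a → sumVec m b (λ v → G (f (suc a) ∷ v)))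

  Bell≈cycleTypeSum : ∀ lam n k →
    Bell R n k (xfun lam) ≈ ιR (cycleTypeSum (suc (n ∸ k)) k n k) * lam ^ᴿ (n ∸ k)
  Bell≈cycleTypeSum lam n k =
    sumR-vecsUpTo (suc (n ∸ k)) k (bellTerm R n k (xfun lam)) (countIf n k) (lam ^ᴿ (n ∸ k)) (bellTerm≈ lam n k)

open RingPart using (Sλ≈stirling; Bell≈cycleTypeSum)

theorem3 : ∀ {c ℓ} (R : CommutativeRing c ℓ) (lam : CommutativeRing.Carrier R)
    (n k : ℕ) → k ≤ n →
    CommutativeRing._≈_ R (Sλ R lam n k)
    (Bell R n k (λ j → CommutativeRing._*_ R (ι R ((j ∸ 1) !)) (_^R_ R lam (j ∸ 1))))
theorem3 R lam n k k≤n = begin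
    Sλ R lam n k
      ≈⟨ Sλ≈stirling R lam n k ⟩
    ι R (stirling n k) * _^R_ R lam (n ∸ k)
      ≈⟨ *-congʳ (reflexive (≡.cong (ι R) (≡.sym counting))) ⟩
    ι R (cycleTypeSum (suc (n ∸ k)) k n k) * _^R_ R lam (n ∸ k)
      ≈⟨ sym (Bell≈cycleTypeSum R lam n k) ⟩
    Bell R n k (λ j → ι R ((j ∸ 1) !) * _^R_ R lam (j ∸ 1)) ∎
  where
  open CommutativeRing R
  open import Relation.Binary.Reasoning.Setoid setoid
  open import Data.Nat using (suc; s≤s)
  open import Data.Nat.Properties using (≤-refl; ≤-reflexive; m∸n+n≡m)
  open import Relation.Binary.PropositionalEquality as ≡ using (_≡_)
  -- step (3), for vectors of length n-k+1 with entries ≤ k, as in Bell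
  counting : cycleTypeSum (suc (n ∸ k)) k n k ≡ stirling n k
  counting = cycleTypeSum≡stirling (suc (n ∸ k)) k k n ≤-refl (s≤s (≤-reflexive (≡.sym (m∸n+n≡m k≤n))))
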